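{- Let $S$ be a factorizable Boolean sublattice all of whose quarks have size at most $2$. Then $S$ is an LFS if and only if $S$ is a UFS.
   Context: Let $B_{\mathbb{N}}$ be the set of all finite subsets of $\mathbb{N}=\{1,2,3,\dots\}$, ordered by inclusion. A Boolean sublattice is a subset $S\subseteq B_{\mathbb{N}}$ containing $\emptyset$ and closed under finite unions. A quark of $S$ is a nonempty $A\in S$ such that no $B\in S$ satisfies $\emptyset\subsetneq B\subsetneq A$; $\mathcal{A}(S)$ is the set of quarks. $S$ is factorizable if every nonempty element is a union of finitely many quarks. For nonempty $X\in S$, a factorization of $X$ in $S$ is a finite set $z\subseteq\mathcal{A}(S)$ with $\bigcup z=X$ and $\bigcup z'\subsetneq X$ for every proper subset $z'\subsetneq z$. $S$ is a UFS if every nonempty $X\in S$ has exactly one factorization; $S$ is an LFS if any two distinct factorizations of the same nonempty element have different sizes. -}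

module Defs where

open import Data.Nat using (ℕ; zero; suc; _≤_; _<_)
open import Data.Bool using (Bool; true; false; _∨_; if_then_else_)
open import Data.List using (List; []; _∷_; foldr; length; upTo; filter)
open import Data.List.Relation.Unary.All using (All)
open import Data.List.Relation.Unary.Any using (Any)
open import Data.List.Relation.Unary.AllPairs using (AllPairs)
open import Data.List.Relation.Binary.Sublist.Propositional using (_⊆_)
open import Data.Product using (Σ; _×_; ∃; _,_)
open import Relation.Binary.PropositionalEquality using (_≡_)
open import Relation.Nullary using (¬_)

-- A finite subset of ℕ = {1,2,3,...}: a Boolean membership predicate that
-- is false at 0 and false from some bound on.
record FinSub : Set where
  field
    mem     : ℕ → Bool
    bound   : ℕ
    no-zero : mem 0 ≡ false
    bounded : ∀ k → bound ≤ k → mem k ≡ false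
open FinSub public

_≐_ : FinSub → FinSub → Set
A ≐ B = ∀ k → mem A k ≡ mem B k

_⊆ₛ_ : FinSub → FinSub → Set
A ⊆ₛ B = ∀ k → mem A k ≡ true → mem B k ≡ true

_⊊ₛ_ : FinSub → FinSub → Set
A ⊊ₛ B = A ⊆ₛ B × ¬ (B ⊆ₛ A)

NonEmpty : FinSub → Set
NonEmpty A = ∃ λ k → mem A k ≡ true

∅ₛ : FinSub
∅ₛ = record { mem = λ _ → false ; bound = 0 ; no-zero = _≡_.refl ; bounded = λ _ _ → _≡_.refl }

private
  ∨-false : ∀ {a b} → a ≡ false → b ≡ false → (a ∨ b) ≡ false
  ∨-false _≡_.refl _≡_.refl = _≡_.refl

  max : ℕ → ℕ → ℕ
  max = Data.Nat._⊔_

open import Data.Nat.Properties using (m⊔n≤o⇒m≤o; m⊔n≤o⇒n≤o)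

_∪ₛ_ : FinSub → FinSub → FinSub
A ∪ₛ B = record
  { mem = λ k → mem A k ∨ mem B k
  ; bound = Data.Nat._⊔_ (bound A) (bound B)
  ; no-zero = ∨-false (no-zero A) (no-zero B)
  ; bounded = λ k le → ∨-false (bounded A k (m⊔n≤o⇒m≤o (bound A) (bound B) le))
                               (bounded B k (m⊔n≤o⇒n≤o (bound A) (bound B) le))
  }

⋃ : List FinSub → FinSub
⋃ = foldr _∪ₛ_ ∅ₛ

card : FinSub → ℕ
card A = length (filter (λ k → Data.Bool._≟_ (mem A k) true) (upTo (bound A)))

record BooleanSublattice (S : FinSub → Set) : Set where
  field
    resp    : ∀ {A B} → A ≐ B → S A → S B
    has-∅   : S ∅ₛ
    ∪-closed : ∀ {A B} → S A → S B → S (A ∪ₛ B)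

IsQuark : (FinSub → Set) → FinSub → Set
IsQuark S A = S A × NonEmpty A × ¬ (∃ λ B → S B × NonEmpty B × B ⊊ₛ A)

-- a finite set of finite subsets, represented as a duplicate-free list
Distinct : List FinSub → Set
Distinct = AllPairs (λ a b → ¬ (a ≐ b))

_≈ₗ_ : List FinSub → List FinSub → Set
z ≈ₗ w = ∀ q → (Any (q ≐_) z → Any (q ≐_) w) × (Any (q ≐_) w → Any (q ≐_) z)

Factorizable : (FinSub → Set) → Set
Factorizable S = ∀ X → S X → NonEmpty X →
  ∃ λ z → All (IsQuark S) z × ⋃ z ≐ X

-- Proper subsets of a duplicate-free list z are its sublists of smaller length.
IsFactorization : (FinSub → Set) → FinSub → List FinSub → Set
IsFactorization S X z =
  Distinct z × All (IsQuark S) z × ⋃ z ≐ X ×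
  (∀ z' → z' ⊆ z → length z' Data.Nat.< length z → ⋃ z' ⊊ₛ X)

IsUFS : (FinSub → Set) → Set
IsUFS S = ∀ X → S X → NonEmpty X →
  (∃ λ z → IsFactorization S X z) ×
  (∀ z w → IsFactorization S X z → IsFactorization S X w → z ≈ₗ w)

IsLFS : (FinSub → Set) → Set
IsLFS S = ∀ X → S X → NonEmpty X → ∀ z w →
  IsFactorization S X z → IsFactorization S X w →
  ¬ (z ≈ₗ w) → ¬ (length z ≡ length w)

-- Quarks of size at most 2 are points and edges. Pruning a cover by quarks to an
-- irredundant one gives a factorization, so the point is that in an LFS two
-- factorizations z and w of X have the same quarks. Suppose q ∈ z is missing
-- from w, and let a be a point of q in no other quark of z. The quark y₁ ∈ w
-- through a is not q, so q = {a, b} and y₁ = {a, c} with c ∉ q; likewise some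
-- y₂ = {b, d} ∈ w has d ∉ q, and the quark y₃ ∈ z through c avoids a, so
-- y₃ = {c, e} with e ∉ y₁. Depending on whether c = d, e = b, e = d or none of
-- these, the quarks contain a triangle, a square or a path on five points, and
-- each of these has two different irredundant covers of the same size, which
-- LFS forbids.

module Submission where

open import Defs
open import Data.Nat using (ℕ; suc; _≤_; _<_; _≟_; _<?_; s≤s; z≤n)
open import Data.Nat.Properties using (≮⇒≥; ≤⇒≯; anyUpTo?; ≤-refl)
open import Data.Bool using (true; false)
import Data.Bool as Bool
open import Data.Bool.Properties using (∨-zeroʳ; ¬-not; not-¬)
open import Data.Unit using (⊤; tt)
open import Data.List using (List; []; _∷_; length; filter; upTo)
open import Data.List.Properties using (length-removeAt′)
open import Data.List.Relation.Unary.All as All using (All; []; _∷_)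
open import Data.List.Relation.Unary.All.Properties using (All¬⇒¬Any)
open import Data.List.Relation.Unary.Any as Any using (Any; here; there; _─_; index; any?)
open import Data.List.Relation.Unary.AllPairs using ([]; _∷_)
open import Data.List.Relation.Binary.Sublist.Propositional using (_⊆_; []; _∷_; _∷ʳ_; ⊆-refl)
open import Data.List.Relation.Binary.Sublist.Propositional.Properties using (All-resp-⊆; Any-resp-⊆)
open import Data.List.Membership.Propositional using (_∈_; find; lose)
open import Data.List.Membership.Propositional.Properties using (∈-upTo⁺; ∈-filter⁺)
open import Data.Product using (_×_; ∃; _,_; proj₁; proj₂)
open import Data.Sum as Sum using (_⊎_; inj₁; inj₂)
open import Data.Empty using (⊥; ⊥-elim)
open import Relation.Nullary using (¬_; Dec; yes; no; contradiction)
open import Relation.Nullary.Decidable using (_×-dec_)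
open import Relation.Unary using (Decidable)
open import Relation.Binary.PropositionalEquality
open import Function using (_∘_; id)

module _ {A : Set} where

  ∈-─ : ∀ {x y : A} {xs} (p : x ∈ xs) → y ∈ xs → y ≡ x ⊎ y ∈ (xs ─ p)
  ∈-─ (here refl) (here refl) = inj₁ refl
  ∈-─ (here _)    (there q)   = inj₂ q
  ∈-─ (there _)   (here refl) = inj₂ (here refl)
  ∈-─ (there p)   (there q)   = Sum.map₂ there (∈-─ p q)

  ∈-─⁺ : ∀ {x y : A} {xs} (p : x ∈ xs) → y ∈ xs → y ≢ x → y ∈ (xs ─ p)
  ∈-─⁺ p q y≢x = Sum.[ (λ y≡x → contradiction y≡x y≢x) , id ]′ (∈-─ p q)

  ─-⊆ : ∀ {x : A} {xs} (p : x ∈ xs) → (xs ─ p) ⊆ xs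
  ─-⊆ (here _)  = _ ∷ʳ ⊆-refl
  ─-⊆ (there p) = refl ∷ ─-⊆ p

  ─-length : ∀ {x : A} {xs n} (p : x ∈ xs) → n ≤ length (xs ─ p) → suc n ≤ length xs
  ─-length {xs = xs} {n} p n≤ = subst (suc n ≤_) (sym (length-removeAt′ xs (index p))) (s≤s n≤)

  three-distinct⇒3≤length : ∀ {x y z : A} {xs} → x ∈ xs → y ∈ xs → z ∈ xs →
    x ≢ y → x ≢ z → y ≢ z → 3 ≤ length xs
  three-distinct⇒3≤length px py pz x≢y x≢z y≢z = ─-length px (─-length py′ (─-length pz′′ z≤n))
    where
    py′ = ∈-─⁺ px py (≢-sym x≢y)
    pz′′ = ∈-─⁺ py′ (∈-─⁺ px pz (≢-sym x≢z)) (≢-sym y≢z)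

⊆ₛ-antisym : ∀ {A B} → A ⊆ₛ B → B ⊆ₛ A → A ≐ B
⊆ₛ-antisym {A} {B} A⊆B B⊆A k with mem A k in Ak | mem B k in Bk
... | true  | true  = refl
... | false | false = refl
... | true  | false = contradiction (A⊆B k Ak) (not-¬ Bk)
... | false | true  = contradiction (B⊆A k Bk) (not-¬ Ak)

≐⇒⊆ₛ : ∀ {A B} → A ≐ B → A ⊆ₛ B
≐⇒⊆ₛ A≐B k Ak = trans (sym (A≐B k)) Ak

differs : ∀ {A B k} → mem A k ≡ true → mem B k ≡ false → ¬ A ≐ B
differs {k = k} Ak Bk A≐B = not-¬ (trans (sym (A≐B k)) Ak) Bk

∈∉⇒≢ : ∀ {A x y} → mem A x ≡ true → mem A y ≡ false → x ≢ y
∈∉⇒≢ Ax Ay refl = not-¬ Ax Ay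

mem⇒<bound : ∀ {A k} → mem A k ≡ true → k < bound A
mem⇒<bound {A} {k} Ak with k <? bound A
... | yes k<b = k<b
... | no k≮b  = contradiction (bounded A k (≮⇒≥ k≮b)) (not-¬ Ak)

∃-mem? : ∀ {P : ℕ → Set} → Decidable P → ∀ A → Dec (∃ λ k → mem A k ≡ true × P k)
∃-mem? {P} P? A with anyUpTo? (λ k → (mem A k Bool.≟ true) ×-dec P? k) (bound A)
... | yes (k , _ , Ak , Pk) = yes (k , Ak , Pk)
... | no none               = no λ (k , Ak , Pk) → none (k , mem⇒<bound {A} Ak , Ak , Pk)

⊆ₛ? : ∀ A B → Dec (A ⊆ₛ B)
⊆ₛ? A B with ∃-mem? (λ k → mem B k Bool.≟ false) A
... | yes (k , Ak , Bk) = no λ A⊆B → not-¬ (A⊆B k Ak) Bk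
... | no none           = yes λ k Ak → ¬-not λ Bk → none (k , Ak , Bk)

⊈ₛ⇒witness : ∀ {A B} → ¬ A ⊆ₛ B → ∃ λ k → mem A k ≡ true × mem B k ≡ false
⊈ₛ⇒witness {A} {B} A⊈B with ∃-mem? (λ k → mem B k Bool.≟ false) A
... | yes witness = witness
... | no none     = contradiction (λ k Ak → ¬-not λ Bk → none (k , Ak , Bk)) A⊈B

≐? : ∀ A B → Dec (A ≐ B)
≐? A B with ⊆ₛ? A B | ⊆ₛ? B A
... | yes A⊆B | yes B⊆A = yes (⊆ₛ-antisym {A} {B} A⊆B B⊆A)
... | no A⊈B  | _       = no λ A≐B → A⊈B (≐⇒⊆ₛ {A} {B} A≐B)
... | yes _   | no B⊈A  = no λ A≐B → B⊈A (≐⇒⊆ₛ {B} {A} λ k → sym (A≐B k))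

_∈⋃_ : ℕ → List FinSub → Set
k ∈⋃ l = Any (λ y → mem y k ≡ true) l

_∉⋃_ : ℕ → List FinSub → Set
k ∉⋃ l = All (λ y → mem y k ≡ false) l

mem-⋃⁺ : ∀ {k l} → k ∈⋃ l → mem (⋃ l) k ≡ true
mem-⋃⁺ (here yk) rewrite yk = refl
mem-⋃⁺ {k} {y ∷ _} (there i) rewrite mem-⋃⁺ i = ∨-zeroʳ (mem y k)

mem-⋃⁻ : ∀ {k} l → mem (⋃ l) k ≡ true → k ∈⋃ l
mem-⋃⁻ {k} (y ∷ l) lk with mem y k in yk
... | true  = here yk
... | false = there (mem-⋃⁻ l lk)

∉⋃⇒mem≡false : ∀ {k l} → k ∉⋃ l → mem (⋃ l) k ≡ false
∉⋃⇒mem≡false []          = refl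
∉⋃⇒mem≡false (yk ∷ rest) rewrite yk = ∉⋃⇒mem≡false rest

∉⋃? : ∀ k l → Dec (k ∉⋃ l)
∉⋃? k = All.all? (λ y → mem y k Bool.≟ false)

∉⋃-or-∈⋃ : ∀ k l → k ∉⋃ l ⊎ k ∈⋃ l
∉⋃-or-∈⋃ k [] = inj₁ []
∉⋃-or-∈⋃ k (y ∷ l) with mem y k in yk | ∉⋃-or-∈⋃ k l
... | true  | _        = inj₂ (here yk)
... | false | inj₁ out = inj₁ (yk ∷ out)
... | false | inj₂ i   = inj₂ (there i)

_⊆⋃_ : FinSub → List FinSub → Set
A ⊆⋃ l = ∀ k → mem A k ≡ true → k ∈⋃ l

∈⇒⊆⋃ : ∀ {y l} → y ∈ l → y ⊆⋃ l
∈⇒⊆⋃ y∈l k yk = lose y∈l yk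

⋃-mono : ∀ {z l} → z ⊆ l → ⋃ z ⊆ₛ ⋃ l
⋃-mono {z} z⊆l k zk = mem-⋃⁺ (Any-resp-⊆ z⊆l (mem-⋃⁻ z zk))

⋃-least : ∀ {l l′} → All (_⊆⋃ l′) l → ⋃ l ⊆ₛ ⋃ l′
⋃-least {l} all k lk with find (mem-⋃⁻ l lk)
... | y , y∈l , yk = mem-⋃⁺ (All.lookup all y∈l k yk)

⋃-closed : ∀ {S} → BooleanSublattice S → ∀ {l} → All S l → S (⋃ l)
⋃-closed BL []         = BooleanSublattice.has-∅ BL
⋃-closed BL (Sy ∷ Sys) = BooleanSublattice.∪-closed BL Sy (⋃-closed BL Sys)

mem⇒∈elements : ∀ {A k} → mem A k ≡ true →
  k ∈ filter (λ j → mem A j Bool.≟ true) (upTo (bound A))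
mem⇒∈elements {A} Ak = ∈-filter⁺ (λ j → mem A j Bool.≟ true) (∈-upTo⁺ (mem⇒<bound {A} Ak)) Ak

record Pair (A : FinSub) (a b : ℕ) : Set where
  field
    distinct : a ≢ b
    ∋-left   : mem A a ≡ true
    ∋-right  : mem A b ≡ true
    only     : ∀ {x} → mem A x ≡ true → x ≡ a ⊎ x ≡ b

card≤2⇒Pair : ∀ {A a b} → card A ≤ 2 → a ≢ b → mem A a ≡ true → mem A b ≡ true → Pair A a b
card≤2⇒Pair {A} {a} {b} card≤2 a≢b Aa Ab = record
  { distinct = a≢b ; ∋-left = Aa ; ∋-right = Ab ; only = only }
  where
  only : ∀ {x} → mem A x ≡ true → x ≡ a ⊎ x ≡ b
  only {x} Ax with x ≟ a | x ≟ b
  ... | yes x≡a | _       = inj₁ x≡a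
  ... | no _    | yes x≡b = inj₂ x≡b
  ... | no x≢a  | no x≢b  = contradiction
    (three-distinct⇒3≤length (mem⇒∈elements {A} Aa) (mem⇒∈elements {A} Ab) (mem⇒∈elements {A} Ax)
      a≢b (≢-sym x≢a) (≢-sym x≢b))
    (≤⇒≯ card≤2)

module _ {A a b} (A=ab : Pair A a b) where
  open Pair A=ab

  Pair-sym : Pair A b a
  Pair-sym = record
    { distinct = ≢-sym distinct ; ∋-left = ∋-right ; ∋-right = ∋-left ; only = Sum.swap ∘ only }

  Pair-∌ : ∀ {x} → a ≢ x → b ≢ x → mem A x ≡ false
  Pair-∌ {x} a≢x b≢x with mem A x in Ax
  ... | false = refl
  ... | true  = Sum.[ (λ x≡a → contradiction (sym x≡a) a≢x) , (λ x≡b → contradiction (sym x≡b) b≢x) ]′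
                  (only Ax)

  Pair-⊆⋃ : ∀ {l} → a ∈⋃ l → b ∈⋃ l → A ⊆⋃ l
  Pair-⊆⋃ a∈ b∈ x Ax = Sum.[ (λ { refl → a∈ }) , (λ { refl → b∈ }) ]′ (only Ax)

open Pair

-- ctx collects the members already passed, so Irredundant [] z says that every
-- member of z has a point lying in no other member.
Irredundant : List FinSub → List FinSub → Set
Irredundant ctx []       = ⊤
Irredundant ctx (x ∷ xs) =
  (∃ λ k → mem x k ≡ true × k ∉⋃ ctx × k ∉⋃ xs) × Irredundant (x ∷ ctx) xs

Irredundant⇒Distinct : ∀ {ctx z} → Irredundant ctx z → Distinct z
Irredundant⇒Distinct {z = []}     _ = []
Irredundant⇒Distinct {z = x ∷ _} ((k , xk , _ , k∉xs) , irr) =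
  All.map (λ {y} yk → differs {x} {y} xk yk) k∉xs ∷ Irredundant⇒Distinct irr

Irredundant⇒shorter-sublist-misses : ∀ {ctx z z′} →
  Irredundant ctx z → z′ ⊆ z → length z′ < length z →
  ∃ λ k → k ∈⋃ z × k ∉⋃ z′ × k ∉⋃ ctx
Irredundant⇒shorter-sublist-misses {z = []} _ [] ()
Irredundant⇒shorter-sublist-misses ((k , xk , k∉ctx , k∉xs) , _) (_ ∷ʳ z′⊆xs) _ =
  k , here xk , All-resp-⊆ z′⊆xs k∉xs , k∉ctx
Irredundant⇒shorter-sublist-misses (_ , irr) (refl ∷ z′⊆xs) (s≤s shorter)
  with Irredundant⇒shorter-sublist-misses irr z′⊆xs shorter
... | k , k∈xs , k∉z′ , xk ∷ k∉ctx = k , there k∈xs , xk ∷ k∉z′ , k∉ctx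

irredundant-subcover : ∀ ctx l →
  ∃ λ z → z ⊆ l × Irredundant ctx z × (∀ {k} → k ∈⋃ l → k ∈⋃ ctx ⊎ k ∈⋃ z)
irredundant-subcover ctx [] = [] , [] , tt , λ ()
irredundant-subcover ctx (x ∷ xs) with ∃-mem? (λ k → ∉⋃? k ctx ×-dec ∉⋃? k xs) x
... | yes (k , xk , k∉ctx , k∉xs) with irredundant-subcover (x ∷ ctx) xs
...   | z , z⊆xs , irr , covers =
  x ∷ z , refl ∷ z⊆xs , ((k , xk , k∉ctx , All-resp-⊆ z⊆xs k∉xs) , irr) , λ where
    (here xj)    → inj₂ (here xj)
    (there j∈xs) → Sum.[ (λ where (here xj)     → inj₂ (here xj)
                                  (there j∈ctx) → inj₁ j∈ctx)
                       , inj₂ ∘ there ]′ (covers j∈xs)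
irredundant-subcover ctx (x ∷ xs) | no no-private-point with irredundant-subcover ctx xs
... | z , z⊆xs , irr , covers = z , x ∷ʳ z⊆xs , irr , λ where
    (there j∈xs)  → covers j∈xs
    {j} (here xj) → redundant j xj (∉⋃-or-∈⋃ j ctx) (∉⋃-or-∈⋃ j xs)
  where
  redundant : ∀ j → mem x j ≡ true → j ∉⋃ ctx ⊎ j ∈⋃ ctx → j ∉⋃ xs ⊎ j ∈⋃ xs →
              j ∈⋃ ctx ⊎ j ∈⋃ z
  redundant j xj (inj₁ j∉ctx) (inj₁ j∉xs) = contradiction (j , xj , j∉ctx , j∉xs) no-private-point
  redundant j xj (inj₂ j∈ctx) _           = inj₁ j∈ctx
  redundant j xj (inj₁ _)     (inj₂ j∈xs) = covers j∈xs

module _ (S : FinSub → Set) where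

  quark-⊆⇒≐ : ∀ {Q R} → IsQuark S Q → IsQuark S R → Q ⊆ₛ R → Q ≐ R
  quark-⊆⇒≐ {Q} {R} (SQ , Q≢∅ , _) (_ , _ , R-minimal) Q⊆R with ⊆ₛ? R Q
  ... | yes R⊆Q = ⊆ₛ-antisym {Q} {R} Q⊆R R⊆Q
  ... | no R⊈Q  = contradiction (Q , SQ , Q≢∅ , Q⊆R , R⊈Q) R-minimal

  quark-⊈ : ∀ {Q R} → IsQuark S Q → IsQuark S R → ¬ Q ≐ R →
    ∃ λ k → mem Q k ≡ true × mem R k ≡ false
  quark-⊈ {Q} {R} QQ QR Q≉R = ⊈ₛ⇒witness {Q} {R} (Q≉R ∘ quark-⊆⇒≐ QQ QR)

  Irredundant⇒IsFactorization : ∀ {X z} → All (IsQuark S) z → Irredundant [] z → ⋃ z ≐ X →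
    IsFactorization S X z
  Irredundant⇒IsFactorization {X} {z} quarks irr ⋃z≐X = Irredundant⇒Distinct irr , quarks , ⋃z≐X , minimal
    where
    minimal : ∀ z′ → z′ ⊆ z → length z′ < length z → ⋃ z′ ⊊ₛ X
    minimal z′ z′⊆z shorter with Irredundant⇒shorter-sublist-misses irr z′⊆z shorter
    ... | k , k∈z , k∉z′ , _ =
      (λ j z′j → ≐⇒⊆ₛ {⋃ z} {X} ⋃z≐X j (⋃-mono z′⊆z j z′j)) ,
      λ X⊆z′ → not-¬ (X⊆z′ k (≐⇒⊆ₛ {⋃ z} {X} ⋃z≐X k (mem-⋃⁺ k∈z)))
                     (∉⋃⇒mem≡false k∉z′)

  factorization-exists : Factorizable S → ∀ {X} → S X → NonEmpty X → ∃ (IsFactorization S X)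
  factorization-exists factorizable {X} SX X≢∅ with factorizable X SX X≢∅
  ... | l , quarks , ⋃l≐X with irredundant-subcover [] l
  ...   | z , z⊆l , irr , covers = z , Irredundant⇒IsFactorization {X} (All-resp-⊆ z⊆l quarks) irr ⋃z≐X
    where
    ⋃l⊆⋃z : ⋃ l ⊆ₛ ⋃ z
    ⋃l⊆⋃z k lk = Sum.[ (λ ()) , mem-⋃⁺ ]′ (covers (mem-⋃⁻ l lk))
    ⋃z≐X : ⋃ z ≐ X
    ⋃z≐X k = trans (⊆ₛ-antisym {⋃ z} {⋃ l} (⋃-mono z⊆l) ⋃l⊆⋃z k) (⋃l≐X k)

  private-point : ∀ {X z q} → IsFactorization S X z → q ∈ z →
    ∃ λ a → mem q a ≡ true × (∀ {y} → y ∈ z → mem y a ≡ true → y ≡ q)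
  private-point {X} {z} {q} (_ , _ , ⋃z≐X , minimal) q∈z
    with ⊈ₛ⇒witness {X} {⋃ (z ─ q∈z)}
           (proj₂ (minimal (z ─ q∈z) (─-⊆ q∈z) (─-length q∈z ≤-refl)))
  ... | a , Xa , a∉rest with find (mem-⋃⁻ z (trans (⋃z≐X a) Xa))
  ...   | y , y∈z , ya = a , subst (λ y → mem y a ≡ true) (only-q y∈z ya) ya , only-q
    where
    only-q : ∀ {y} → y ∈ z → mem y a ≡ true → y ≡ q
    only-q y∈z ya = Sum.[ id , (λ y∈rest → contradiction a∉rest (not-¬ (mem-⋃⁺ (lose y∈rest ya)))) ]′
      (∈-─ q∈z y∈z)

  point-covered : ∀ {X z w y k} → IsFactorization S X z → IsFactorization S X w →
    y ∈ z → mem y k ≡ true → k ∈⋃ w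
  point-covered {k = k} (_ , _ , ⋃z≐X , _) (_ , _ , ⋃w≐X , _) y∈z yk =
    mem-⋃⁻ _ (trans (⋃w≐X k) (trans (sym (⋃z≐X k)) (mem-⋃⁺ (lose y∈z yk))))

-- Configurations of two-point quarks excluded by LFS

module _ (S : FinSub → Set) (BL : BooleanSublattice S) (lfs : IsLFS S) where

  no-rival-of-equal-size : ∀ {L₁ L₂ x} → All (IsQuark S) L₁ → All (IsQuark S) L₂ →
    Irredundant [] L₁ → Irredundant [] L₂ → All (_⊆⋃ L₂) L₁ → All (_⊆⋃ L₁) L₂ →
    length L₁ ≡ length L₂ → x ∈ L₁ → All (λ y → ¬ x ≐ y) L₂ → ⊥
  no-rival-of-equal-size {L₁} {L₂} {x} Q₁ Q₂ irr₁ irr₂ L₁⊆ L₂⊆ same-length x∈L₁ x-absent =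
    lfs (⋃ L₁) (⋃-closed BL (All.map proj₁ Q₁)) nonempty L₁ L₂
      (Irredundant⇒IsFactorization S {⋃ L₁} Q₁ irr₁ (λ _ → refl))
      (Irredundant⇒IsFactorization S {⋃ L₁} Q₂ irr₂
        (⊆ₛ-antisym {⋃ L₂} {⋃ L₁} (⋃-least L₂⊆) (⋃-least L₁⊆)))
      (λ L₁≈L₂ → All¬⇒¬Any x-absent (proj₁ (L₁≈L₂ x) (lose x∈L₁ (λ _ → refl))))
      same-length
    where
    nonempty : NonEmpty (⋃ L₁)
    nonempty with proj₁ (proj₂ (All.lookup Q₁ x∈L₁))
    ... | k , xk = k , mem-⋃⁺ (lose x∈L₁ xk)

  no-triangle : ∀ {q r s a b c} → IsQuark S q → IsQuark S r → IsQuark S s →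
    Pair q a b → Pair r a c → Pair s b c → ⊥
  no-triangle {q} {r} {s} {a} {b} {c} Qq Qr Qs q=ab r=ac s=bc =
    no-rival-of-equal-size {q ∷ r ∷ []} {q ∷ s ∷ []} (Qq ∷ Qr ∷ []) (Qq ∷ Qs ∷ [])
      ((b , ∋-right q=ab , [] , r∌b ∷ []) , (c , ∋-right r=ac , q∌c ∷ [] , []) , tt)
      ((a , ∋-left q=ab , [] , s∌a ∷ []) , (c , ∋-right s=bc , q∌c ∷ [] , []) , tt)
      (∈⇒⊆⋃ (here refl) ∷ Pair-⊆⋃ r=ac (here (∋-left q=ab)) (there (here (∋-right s=bc))) ∷ [])
      (∈⇒⊆⋃ (here refl) ∷ Pair-⊆⋃ s=bc (here (∋-right q=ab)) (there (here (∋-right r=ac))) ∷ [])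
      refl (there (here refl))
      (differs {r} {q} (∋-right r=ac) q∌c ∷ differs {r} {s} (∋-left r=ac) s∌a ∷ [])
    where
    a≢b = distinct q=ab
    a≢c = distinct r=ac
    b≢c = distinct s=bc
    q∌c = Pair-∌ q=ab a≢c b≢c
    r∌b = Pair-∌ r=ac a≢b (≢-sym b≢c)
    s∌a = Pair-∌ s=bc (≢-sym a≢b) (≢-sym a≢c)

  no-square : ∀ {q r s t a b c d} → IsQuark S q → IsQuark S r → IsQuark S s → IsQuark S t →
    Pair q a b → Pair r a c → Pair s c d → Pair t b d → a ≢ d → b ≢ c → ⊥
  no-square {q} {r} {s} {t} {a} {b} {c} {d} Qq Qr Qs Qt q=ab r=ac s=cd t=bd a≢d b≢c =
    no-rival-of-equal-size {q ∷ s ∷ []} {r ∷ t ∷ []} (Qq ∷ Qs ∷ []) (Qr ∷ Qt ∷ [])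
      ((a , ∋-left q=ab , [] , s∌a ∷ []) , (c , ∋-left s=cd , q∌c ∷ [] , []) , tt)
      ((a , ∋-left r=ac , [] , t∌a ∷ []) , (d , ∋-right t=bd , r∌d ∷ [] , []) , tt)
      (Pair-⊆⋃ q=ab (here (∋-left r=ac)) (there (here (∋-left t=bd))) ∷
       Pair-⊆⋃ s=cd (here (∋-right r=ac)) (there (here (∋-right t=bd))) ∷ [])
      (Pair-⊆⋃ r=ac (here (∋-left q=ab)) (there (here (∋-left s=cd))) ∷
       Pair-⊆⋃ t=bd (here (∋-right q=ab)) (there (here (∋-right s=cd))) ∷ [])
      refl (here refl)
      (differs {q} {r} (∋-right q=ab) r∌b ∷ differs {q} {t} (∋-left q=ab) t∌a ∷ [])
    where
    a≢b = distinct q=ab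
    a≢c = distinct r=ac
    c≢d = distinct s=cd
    b≢d = distinct t=bd
    q∌c = Pair-∌ q=ab a≢c b≢c
    r∌b = Pair-∌ r=ac a≢b (≢-sym b≢c)
    r∌d = Pair-∌ r=ac a≢d c≢d
    s∌a = Pair-∌ s=cd (≢-sym a≢c) (≢-sym a≢d)
    t∌a = Pair-∌ t=bd (≢-sym a≢b) (≢-sym a≢d)

  no-path : ∀ {q r s t a b c d e} → IsQuark S q → IsQuark S r → IsQuark S s → IsQuark S t →
    Pair q a b → Pair r a c → Pair s c e → Pair t b d →
    a ≢ d → a ≢ e → b ≢ c → b ≢ e → c ≢ d → d ≢ e → ⊥
  no-path {q} {r} {s} {t} {a} {b} {c} {d} {e} Qq Qr Qs Qt q=ab r=ac s=ce t=bd a≢d a≢e b≢c b≢e c≢d d≢e =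
    no-rival-of-equal-size {s ∷ r ∷ t ∷ []} {s ∷ q ∷ t ∷ []}
      (Qs ∷ Qr ∷ Qt ∷ []) (Qs ∷ Qq ∷ Qt ∷ [])
      ((e , ∋-right s=ce , [] , r∌e ∷ t∌e ∷ []) , (a , ∋-left r=ac , s∌a ∷ [] , t∌a ∷ []) ,
       (d , ∋-right t=bd , r∌d ∷ s∌d ∷ [] , []) , tt)
      ((e , ∋-right s=ce , [] , q∌e ∷ t∌e ∷ []) , (a , ∋-left q=ab , s∌a ∷ [] , t∌a ∷ []) ,
       (d , ∋-right t=bd , q∌d ∷ s∌d ∷ [] , []) , tt)
      (∈⇒⊆⋃ (here refl) ∷ Pair-⊆⋃ r=ac (there (here (∋-left q=ab))) (here (∋-left s=ce)) ∷
       ∈⇒⊆⋃ (there (there (here refl))) ∷ [])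
      (∈⇒⊆⋃ (here refl) ∷
       Pair-⊆⋃ q=ab (there (here (∋-left r=ac))) (there (there (here (∋-left t=bd)))) ∷
       ∈⇒⊆⋃ (there (there (here refl))) ∷ [])
      refl (there (here refl))
      (differs {r} {s} (∋-left r=ac) s∌a ∷ differs {r} {q} (∋-right r=ac) q∌c ∷
       differs {r} {t} (∋-left r=ac) t∌a ∷ [])
    where
    a≢b = distinct q=ab
    a≢c = distinct r=ac
    c≢e = distinct s=ce
    b≢d = distinct t=bd
    q∌c = Pair-∌ q=ab a≢c b≢c
    q∌d = Pair-∌ q=ab a≢d b≢d
    q∌e = Pair-∌ q=ab a≢e b≢e
    r∌d = Pair-∌ r=ac a≢d c≢d
    r∌e = Pair-∌ r=ac a≢e c≢e
    s∌a = Pair-∌ s=ce (≢-sym a≢c) (≢-sym a≢e)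
    s∌d = Pair-∌ s=ce c≢d (≢-sym d≢e)
    t∌a = Pair-∌ t=bd (≢-sym a≢b) (≢-sym a≢d)
    t∌e = Pair-∌ t=bd b≢e d≢e

  no-four-quark-walk : ∀ {q r s t a b c d e} → IsQuark S q → IsQuark S r → IsQuark S s → IsQuark S t →
    Pair q a b → Pair r a c → Pair s c e → Pair t b d →
    mem q c ≡ false → mem q d ≡ false → mem r e ≡ false → ⊥
  no-four-quark-walk {q} {r} {b = b} {c} {d} {e} Qq Qr Qs Qt q=ab r=ac s=ce t=bd q∌c q∌d r∌e
    with c ≟ d | e ≟ b | e ≟ d
  ... | yes refl | _        | _        = no-triangle Qq Qr Qt q=ab r=ac t=bd
  ... | no _     | yes refl | _        = no-triangle Qq Qr Qs q=ab r=ac (Pair-sym s=ce)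
  ... | no _     | no _     | yes refl =
    no-square Qq Qr Qs Qt q=ab r=ac s=ce t=bd
      (∈∉⇒≢ {q} (∋-left q=ab) q∌d) (∈∉⇒≢ {q} (∋-right q=ab) q∌c)
  ... | no c≢d   | no e≢b   | no e≢d   =
    no-path Qq Qr Qs Qt q=ab r=ac s=ce t=bd
      (∈∉⇒≢ {q} (∋-left q=ab) q∌d) (∈∉⇒≢ {r} (∋-left r=ac) r∌e)
      (∈∉⇒≢ {q} (∋-right q=ab) q∌c) (≢-sym e≢b) c≢d (≢-sym e≢d)

-- Uniqueness of factorizations

module _ (S : FinSub → Set) (BL : BooleanSublattice S)
         (card≤2 : ∀ A → IsQuark S A → card A ≤ 2) (lfs : IsLFS S) where

  quark-neighbour : ∀ {Q R a} → IsQuark S Q → IsQuark S R → ¬ Q ≐ R →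
    mem Q a ≡ true → mem R a ≡ true →
    ∃ λ c → Pair R a c × mem Q c ≡ false
  quark-neighbour {Q} {R} QQ QR Q≉R Qa Ra with quark-⊈ S QR QQ (λ R≐Q → Q≉R λ k → sym (R≐Q k))
  ... | c , Rc , Qc = c , card≤2⇒Pair (card≤2 R QR) (∈∉⇒≢ {Q} Qa Qc) Ra Rc , Qc

  module _ {X z w} (fz : IsFactorization S X z) (fw : IsFactorization S X w) where

    quarkᶻ : ∀ {y} → y ∈ z → IsQuark S y
    quarkᶻ = All.lookup (proj₁ (proj₂ fz))

    quarkʷ : ∀ {y} → y ∈ w → IsQuark S y
    quarkʷ = All.lookup (proj₁ (proj₂ fw))

    quark-not-absent : ∀ {q} → q ∈ z → ¬ ¬ Any (q ≐_) w
    quark-not-absent {q} q∈z q∉w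
      with private-point S {X} fz q∈z
    ... | a , qa , a-private
      with find (point-covered S {X} fz fw q∈z qa)
    ... | y₁ , y₁∈w , y₁a
      with quark-⊈ S (quarkᶻ q∈z) (quarkʷ y₁∈w) (q∉w ∘ lose y₁∈w)
    ... | b , qb , y₁∌b
      with find (point-covered S {X} fz fw q∈z qb)
    ... | y₂ , y₂∈w , y₂b
      with quark-neighbour (quarkᶻ q∈z) (quarkʷ y₁∈w) (q∉w ∘ lose y₁∈w) qa y₁a
         | quark-neighbour (quarkᶻ q∈z) (quarkʷ y₂∈w) (q∉w ∘ lose y₂∈w) qb y₂b
    ... | c , y₁=ac , q∌c | d , y₂=bd , q∌d
      with find (point-covered S {X} fw fz y₁∈w (∋-right y₁=ac))
    ... | y₃ , y₃∈z , y₃c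
      with quark-neighbour (quarkʷ y₁∈w) (quarkᶻ y₃∈z) (differs {y₁} {y₃} y₁a (avoids-a y₃∈z y₃c))
             (∋-right y₁=ac) y₃c
      where
      avoids-a : ∀ {y} → y ∈ z → mem y c ≡ true → mem y a ≡ false
      avoids-a y∈z yc = ¬-not λ ya → not-¬ (subst (λ y → mem y c ≡ true) (a-private y∈z ya) yc) q∌c
    ... | e , y₃=ce , y₁∌e =
      no-four-quark-walk S BL lfs (quarkᶻ q∈z) (quarkʷ y₁∈w) (quarkᶻ y₃∈z) (quarkʷ y₂∈w)
        (card≤2⇒Pair (card≤2 q (quarkᶻ q∈z)) (∈∉⇒≢ {y₁} y₁a y₁∌b) qa qb) y₁=ac y₃=ce y₂=bd
        q∌c q∌d y₁∌e

    quark-reappears : ∀ {q} → q ∈ z → Any (q ≐_) w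
    quark-reappears {q} q∈z with any? (≐? q) w
    ... | yes q∈w = q∈w
    ... | no q∉w  = ⊥-elim (quark-not-absent q∈z q∉w)

  factorizations-agree : ∀ {X z w} → IsFactorization S X z → IsFactorization S X w → z ≈ₗ w
  factorizations-agree {X} fz fw x = included fz fw , included fw fz
    where
    included : ∀ {z w} → IsFactorization S X z → IsFactorization S X w → Any (x ≐_) z → Any (x ≐_) w
    included fz fw x∈z with find x∈z
    ... | y , y∈z , x≐y = Any.map (λ y≐y′ k → trans (x≐y k) (y≐y′ k)) (quark-reappears {X} fz fw y∈z)

proposition7p3 : (S : FinSub → Set) → BooleanSublattice S → Factorizable S →
    (∀ A → IsQuark S A → card A ≤ 2) →
    (IsLFS S → IsUFS S) × (IsUFS S → IsLFS S)
proposition7p3 S BL factorizable card≤2 = LFS⇒UFS , UFS⇒LFS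
  where
  LFS⇒UFS : IsLFS S → IsUFS S
  LFS⇒UFS lfs X SX X≢∅ =
    factorization-exists S factorizable SX X≢∅ ,
    λ z w fz fw → factorizations-agree S BL card≤2 lfs {X} fz fw
  UFS⇒LFS : IsUFS S → IsLFS S
  UFS⇒LFS ufs X SX X≢∅ z w fz fw z≉w _ = z≉w (proj₂ (ufs X SX X≢∅) z w fz fw)
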